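{- Consider the EXAM with an arbitrary pool template, and let $s$ be a reachable final state (no transition applies to $s$). Then there is a $\beta$-normal form $f$ such that $s=(f,P,E)$ for some environment $E$ and some pool $P$ with $\mathrm{supp}(P)=\emptyset$, and $\mathrm{rb}(s)=f$. Moreover, if $s\equiv s'$ then $s'$ is final and $\mathrm{rb}(s')=f$.
   Context: Pre-terms $t ::= x\mid\lambda x.t\mid t\,t$; $t\{x:=u\}$ capture-avoiding substitution; a pre-term is well-named if its bound variables are pairwise distinct. A $\beta$-normal form contains no subterm $(\lambda x.t)\,u$. Stacks $S ::= \epsilon\mid t:S$. Environments $E ::= \epsilon\mid[x\leftarrow t]:E$; $\mathrm{dom}(E)$, $E(x)$ the pre-term of the (leftmost) entry for $x$. Named multi-contexts $\mathbb{C} ::= x\mid\langle\cdot\rangle_\alpha\mid\lambda x.\mathbb{C}\mid\mathbb{C}\,\mathbb{C}$; $\mathbb{C}\{\alpha\leftarrow\mathbb{C}'\}$ capture-allowing replacement. Approximants $\mathbb{B} ::= \langle\cdot\rangle_\alpha\mid\mathbb{R}\mid\lambda x.\mathbb{B}$, $\mathbb{R} ::= x\mid\mathbb{R}\,\mathbb{B}$. Jobs $(t,S)_\alpha$. Pool templates provide pools $P$ with $\mathrm{names}(P)$, a support $\mathrm{supp}(P)$ of jobs indexed bijectively by $\mathrm{names}(P)$, $\mathrm{new}(j_\alpha)$ with support $\{j_\alpha\}$, a selection relation $\mathrm{sel}(P,j_\alpha,P')$ with $j_\alpha\in\mathrm{supp}(P)$ and $\mathrm{supp}(P')=\mathrm{supp}(P)\setminus\{j_\alpha\}$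 such that some selection exists whenever $\mathrm{supp}(P)\neq\emptyset$, and $\mathrm{drop}(j_\alpha,P)$, $\mathrm{add}(j_\alpha,P)$ defined for $\alpha\notin\mathrm{names}(P)$ with support $\mathrm{supp}(P)\cup\{j_\alpha\}$; $\mathrm{add}$ extends to lists left to right. EXAM: states $(\mathbb{B},P,E)$; initialization $t\triangleright(\langle\cdot\rangle_\alpha,\mathrm{new}((t',\epsilon)_\alpha),\epsilon)$, $t'$ a well-named pre-term $\alpha$-equivalent to $t$. Transitions from $(\mathbb{B},P,E)$ after $\mathrm{sel}(P,j_\alpha,P')$: ($\mathtt{sea}_@$) $(t\,u,S)_\alpha\Rightarrow(\mathbb{B},\mathrm{drop}((t,u:S)_\alpha,P'),E)$; ($\beta$) $(\lambda x.t,u:S)_\alpha\Rightarrow(\mathbb{B},\mathrm{drop}((t,S)_\alpha,P'),[x\leftarrow u]:E)$; ($\mathtt{sub}$) $(x,S)_\alpha$ with $x\in\mathrm{dom}(E)\Rightarrow(\mathbb{B},\mathrm{drop}((t',S)_\alpha,P'),E)$, $t'$ a fresh well-named renaming of $E(x)$; ($\mathtt{sea}_\lambda$) $(\lambda x.t,\epsilon)_\alpha\Rightarrow(\mathbb{B}\{\alpha\leftarrow\lambda x.\langle\cdot\rangle_\alpha\},\mathrm{drop}((t,\epsilon)_\alpha,P'),E)$; ($\mathtt{sea}_{\mathcal V}$) $(x,t_1:\dots:t_n)_\alpha$ with $n\ge0$, $x\notin\mathrm{dom}(E)\Rightarrow(\mathbb{B}\{\alpha\leftarrow x\,\langle\cdot\rangle_{\beta_1}\cdots\langle\cdot\rangle_{\beta_n}\},\mathrm{add}((t_1,\epsilon)_{\beta_1}:\dots:(t_n,\epsilon)_{\beta_n},P'),E)$,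 fresh $\beta_i$. Reachable states are those obtained from initial states by finitely many transitions. Read-back: $t\downarrow\epsilon:=t$, $t\downarrow([x\leftarrow u]:E):=(t\{x:=u\})\downarrow E$; stacks pointwise; $\langle t\mid\epsilon\rangle:=t$, $\langle t\mid u:S\rangle:=\langle t\,u\mid S\rangle$; $(t,S)_\alpha\downarrow E:=(t\downarrow E,S\downarrow E)_\alpha$, lifted to sets; $\mathrm{rb}((t,S)_\alpha):=\langle t\mid S\rangle$; $\mathbb{C}_X:=\mathbb{C}\{\alpha_1\leftarrow\mathrm{rb}(j_{\alpha_1})\}\cdots\{\alpha_n\leftarrow\mathrm{rb}(j_{\alpha_n})\}$; $\mathrm{rb}((\mathbb{B},P,E)):=\mathbb{B}_{\mathrm{supp}(P)\downarrow E}$. $\approx$ is the least equivalence relation on environments containing $E:[x\leftarrow t]:[y\leftarrow u]:E'\sim E:[y\leftarrow u]:[x\leftarrow t]:E'$ whenever $x$ does not occur in $u$ and $y$ does not occur in $t$; $(\mathbb{B},P,E_1)\equiv(\mathbb{B},P,E_2)$ iff $E_1\approx E_2$. -}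

module Defs where

open import Data.Nat using (ℕ; zero; suc; _⊔_; _≡ᵇ_)
open import Data.Bool using (Bool; true; false; if_then_else_; not)
open import Data.List using (List; []; _∷_; _++_; map; foldr; foldl; concatMap; length; zipWith; filterᵇ)
open import Data.List.Membership.Propositional using (_∈_; _∉_)
open import Data.List.Relation.Unary.Unique.Propositional using (Unique)
open import Data.Bool.ListAction using (any)
open import Data.Maybe using (Maybe; just; nothing)
open import Data.Product using (Σ; ∃; _×_; _,_; proj₁)
open import Data.Sum using (_⊎_)
open import Relation.Binary.PropositionalEquality using (_≡_; _≢_)
open import Relation.Nullary using (¬_)
open import Function.Bundles using (_⇔_)

Var : Set
Var = ℕ

Name : Set
Name = ℕ

data Term : Set where
  var : Var → Term
  lam : Var → Term → Term
  app : Term → Term → Term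

remove : Var → List Var → List Var
remove x = filterᵇ (λ y → not (y ≡ᵇ x))

fv : Term → List Var
fv (var x)   = x ∷ []
fv (lam x t) = remove x (fv t)
fv (app t u) = fv t ++ fv u

vars : Term → List Var
vars (var x)   = x ∷ []
vars (lam x t) = x ∷ vars t
vars (app t u) = vars t ++ vars u

bv : Term → List Var
bv (var x)   = []
bv (lam x t) = x ∷ bv t
bv (app t u) = bv t ++ bv u

WellNamed : Term → Set
WellNamed t = Unique (bv t)

memᵇ : Var → List Var → Bool
memᵇ x l = any (x ≡ᵇ_) l

fresh : List Var → Var
fresh l = suc (foldr _⊔_ 0 l)

-- Capture-avoiding (simultaneous) substitution; a binder is renamed
-- (to a fresh variable) only when it would capture.

Subst : Set
Subst = Var → Term

_[_↦_] : Subst → Var → Term → Subst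
(σ [ x ↦ u ]) y = if y ≡ᵇ x then u else σ y

ssub : Subst → Term → Term
ssub σ (var x)   = σ x
ssub σ (app t u) = app (ssub σ t) (ssub σ u)
ssub σ (lam x t) = lam z (ssub (σ [ x ↦ var z ]) t)
  where
    avoid : List Var
    avoid = concatMap (λ w → fv (σ w)) (fv (lam x t))
    z : Var
    z = if memᵇ x avoid then fresh (avoid ++ vars t) else x

_⟦_≔_⟧ : Term → Var → Term → Term
t ⟦ x ≔ u ⟧ = ssub (var [ x ↦ u ]) t

data _=α_ : Term → Term → Set where
  var : ∀ x → var x =α var x
  app : ∀ {a a' b b'} → a =α a' → b =α b' → app a b =α app a' b'
  lam : ∀ {x y a b} z → z ∉ vars (lam x a) → z ∉ vars (lam y b) →
        (a ⟦ x ≔ var z ⟧) =α (b ⟦ y ≔ var z ⟧) → lam x a =α lam y b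

data HasRedex : Term → Set where
  here : ∀ {x t u} → HasRedex (app (lam x t) u)
  appl : ∀ {t u} → HasRedex t → HasRedex (app t u)
  appr : ∀ {t u} → HasRedex u → HasRedex (app t u)
  under : ∀ {x t} → HasRedex t → HasRedex (lam x t)

BetaNormal : Term → Set
BetaNormal t = ¬ HasRedex t

Stack : Set
Stack = List Term

Env : Set
Env = List (Var × Term)

dom : Env → List Var
dom = map proj₁

lookupEnv : Env → Var → Maybe Term
lookupEnv [] x = nothing
lookupEnv ((y , t) ∷ E) x = if x ≡ᵇ y then just t else lookupEnv E x

data Ctx : Set where
  cvar : Var → Ctx
  hole : Name → Ctx
  clam : Var → Ctx → Ctx
  capp : Ctx → Ctx → Ctx

-- C{α ← C'} (capture-allowing)
replace : Ctx → Name → Ctx → Ctx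
replace (cvar x) α C' = cvar x
replace (hole β) α C' = if β ≡ᵇ α then C' else hole β
replace (clam x C) α C' = clam x (replace C α C')
replace (capp C D) α C' = capp (replace C α C') (replace D α C')

toCtx : Term → Ctx
toCtx (var x) = cvar x
toCtx (lam x t) = clam x (toCtx t)
toCtx (app t u) = capp (toCtx t) (toCtx u)

holes : Ctx → List Name
holes (cvar x) = []
holes (hole α) = α ∷ []
holes (clam x C) = holes C
holes (capp C D) = holes C ++ holes D

cvars : Ctx → List Var
cvars (cvar x) = x ∷ []
cvars (hole α) = []
cvars (clam x C) = x ∷ cvars C
cvars (capp C D) = cvars C ++ cvars D

mutual
  data IsB : Ctx → Set where
    bhole : ∀ α → IsB (hole α)
    brig  : ∀ {C} → IsR C → IsB C
    blam  : ∀ {x C} → IsB C → IsB (clam x C)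

  data IsR : Ctx → Set where
    rvar : ∀ x → IsR (cvar x)
    rapp : ∀ {C D} → IsR C → IsB D → IsR (capp C D)

record Job : Set where
  constructor job
  field
    tm  : Term
    stk : Stack
    nm  : Name
open Job public

-- Pool templates (supports are finite sets, represented by lists and
-- only used through membership)

record PoolTemplate : Set₁ where
  field
    Pool  : Set
    names : Pool → List Name
    supp  : Pool → List Job
    names-supp : ∀ P α → (α ∈ names P) ⇔ (Σ Job λ j → j ∈ supp P × nm j ≡ α)
    supp-inj   : ∀ P j j' → j ∈ supp P → j' ∈ supp P → nm j ≡ nm j' → j ≡ j'
    new      : Job → Pool
    new-supp : ∀ j j' → (j' ∈ supp (new j)) ⇔ (j' ≡ j)
    sel      : Pool → Job → Pool → Set
    sel-mem  : ∀ {P j P'} → sel P j P' → j ∈ supp P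
    sel-supp : ∀ {P j P'} → sel P j P' → ∀ j' → (j' ∈ supp P') ⇔ (j' ∈ supp P × j' ≢ j)
    sel-exists : ∀ P j → j ∈ supp P → Σ Job λ j' → Σ Pool λ P' → sel P j' P'
    drop : Job → Pool → Pool
    add  : Job → Pool → Pool
    -- specification of drop/add where they are defined (α ∉ names P)
    drop-supp : ∀ j P → nm j ∉ names P → ∀ j' → (j' ∈ supp (drop j P)) ⇔ (j' ∈ supp P ⊎ j' ≡ j)
    add-supp  : ∀ j P → nm j ∉ names P → ∀ j' → (j' ∈ supp (add j P)) ⇔ (j' ∈ supp P ⊎ j' ≡ j)

_↓_ : Term → Env → Term
t ↓ [] = t
t ↓ ((x , u) ∷ E) = (t ⟦ x ≔ u ⟧) ↓ E

plug : Term → Stack → Term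
plug t [] = t
plug t (u ∷ S) = plug (app t u) S

jobDown : Env → Job → Job
jobDown E (job t S α) = job (t ↓ E) (map (_↓ E) S) α

rbJob : Job → Term
rbJob (job t S α) = plug t S

fill : List Job → Ctx → Ctx
fill X C = foldl (λ D j → replace D (nm j) (toCtx (rbJob j))) C X

data _∼_ : Env → Env → Set where
  swap : ∀ E x t y u E' → x ∉ vars u → y ∉ vars t →
         (E ++ (x , t) ∷ (y , u) ∷ E') ∼ (E ++ (y , u) ∷ (x , t) ∷ E')

data _≈_ : Env → Env → Set where
  emb   : ∀ {E E'} → E ∼ E' → E ≈ E'
  refl≈ : ∀ {E} → E ≈ E
  sym≈  : ∀ {E E'} → E ≈ E' → E' ≈ E
  trans≈ : ∀ {E E' E''} → E ≈ E' → E' ≈ E'' → E ≈ E''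

module Exam (T : PoolTemplate) where
  open PoolTemplate T

  State : Set
  State = Ctx × Pool × Env

  varsJob : Job → List Var
  varsJob (job t S α) = vars t ++ concatMap vars S

  varsEnv : Env → List Var
  varsEnv = concatMap (λ { (x , t) → x ∷ vars t })

  varsState : State → List Var
  varsState (B , P , E) = cvars B ++ concatMap varsJob (supp P) ++ varsEnv E

  FreshRenaming : State → Term → Term → Set
  FreshRenaming s u t' = (t' =α u) × WellNamed t' × (∀ y → y ∈ bv t' → y ∉ varsState s)

  headCtx : Var → List Name → Ctx
  headCtx x βs = foldl (λ C β → capp C (hole β)) (cvar x) βs

  addList : List Job → Pool → Pool
  addList [] P = P
  addList (j ∷ js) P = addList js (add j P)

  data Init : Term → State → Set where
    init : ∀ t t' α → WellNamed t' → t' =α t →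
           Init t (hole α , new (job t' [] α) , [])

  data Step : State → State → Set where
    sea-app : ∀ {B P E P' t u S α} → sel P (job (app t u) S α) P' →
           Step (B , P , E) (B , drop (job t (u ∷ S) α) P' , E)
    beta : ∀ {B P E P' x t u S α} → sel P (job (lam x t) (u ∷ S) α) P' →
           Step (B , P , E) (B , drop (job t S α) P' , (x , u) ∷ E)
    sub  : ∀ {B P E P' x S α u t'} → sel P (job (var x) S α) P' →
           lookupEnv E x ≡ just u → FreshRenaming (B , P , E) u t' →
           Step (B , P , E) (B , drop (job t' S α) P' , E)
    sea-lam : ∀ {B P E P' x t α} → sel P (job (lam x t) [] α) P' →
           Step (B , P , E) (replace B α (clam x (hole α)) , drop (job t [] α) P' , E)
    sea-var : ∀ {B P E P' x ts α} → sel P (job (var x) ts α) P' → x ∉ dom E →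
           (βs : List Name) → length βs ≡ length ts → Unique βs →
           (∀ β' → β' ∈ βs → β' ∉ names P × β' ∉ holes B) →
           Step (B , P , E)
                (replace B α (headCtx x βs) ,
                 addList (zipWith (λ t β' → job t [] β') ts βs) P' , E)

  data Reachable : State → Set where
    start : ∀ {t s} → Init t s → Reachable s
    next  : ∀ {s s'} → Reachable s → Step s s' → Reachable s'

  Final : State → Set
  Final s = ∀ s' → ¬ Step s s'

  rb : State → Ctx
  rb (B , P , E) = fill (map (jobDown E) (supp P)) B

  data _≡s_ : State → State → Set where
    eqv : ∀ {B P E₁ E₂} → E₁ ≈ E₂ → (B , P , E₁) ≡s (B , P , E₂)

module Submission where

-- Along every run the approximant B has only holes named by jobs of the pool, so a final
-- state whose pool is empty has a hole-free approximant, i.e. a β-normal form, and its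
-- read-back is B itself.  The pool of a final state is empty because a selected job always
-- enables a transition; for sub this needs a fresh well-named renaming of E(x), obtained by
-- relabelling the binders with consecutive numbers above every variable in sight.  An
-- equivalent state differs only in its environment, so it keeps the empty pool.

open import Defs
open import Data.Bool using (true; false; T; not; if_then_else_)
open import Data.Bool.Properties using (T-≡)
open import Data.Empty using (⊥-elim)
open import Data.List
  using (List; []; _∷_; _++_; map; concatMap; length; zipWith; foldr; foldl; applyUpTo)
open import Data.List.Properties using (length-applyUpTo)
open import Data.List.Membership.Propositional using (_∈_; _∉_; find)
open import Data.List.Membership.Propositional.Properties
  using (∈-++⁺ˡ; ∈-++⁺ʳ; ∈-++⁻; ∈-map⁺; ∈-filter⁺; ∈-filter⁻; ∈-concatMap⁻; ∈-applyUpTo⁻)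
open import Data.List.Relation.Binary.Subset.Propositional using (_⊆_)
open import Data.List.Relation.Unary.Any using (here; there)
import Data.List.Relation.Unary.All as All
open import Data.List.Relation.Unary.AllPairs using ([]; _∷_)
open import Data.List.Relation.Unary.Unique.Propositional using (Unique)
open import Data.List.Relation.Unary.Unique.Propositional.Properties using (++⁺; applyUpTo⁺₁)
open import Data.Maybe using (just; nothing)
open import Data.Nat using (ℕ; suc; _+_; _≤_; _<_; _⊔_; _≡ᵇ_; _≟_; s≤s; z≤n)
open import Data.Nat.Properties
open import Data.Product using (Σ; ∃; _×_; _,_; proj₁; proj₂)
import Data.Product as Product
open import Data.Sum using (_⊎_; inj₁; inj₂; map₂)
import Data.Sum as Sum
open import Function using (_∘_; id)
open import Function.Bundles using (_⇔_; Equivalence)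
open import Relation.Nullary using (¬_; yes; no)
open import Relation.Nullary.Decidable using (T?)
open import Relation.Binary.PropositionalEquality
  using (_≡_; _≢_; refl; sym; trans; cong; cong₂; subst; subst₂; module ≡-Reasoning)
open Equivalence using (to; from)

≡ᵇ-refl : ∀ n → (n ≡ᵇ n) ≡ true
≡ᵇ-refl n = to T-≡ (≡⇒≡ᵇ n n refl)

≢⇒≡ᵇ-false : ∀ {m n} → m ≢ n → (m ≡ᵇ n) ≡ false
≢⇒≡ᵇ-false {m} {n} m≢n with m ≡ᵇ n in eq
... | true  = ⊥-elim (m≢n (≡ᵇ⇒≡ m n (from T-≡ eq)))
... | false = refl

memᵇ-false : ∀ {x} l → x ∉ l → memᵇ x l ≡ false
memᵇ-false []      _   = refl
memᵇ-false (y ∷ l) x∉ rewrite ≢⇒≡ᵇ-false (x∉ ∘ here) = memᵇ-false l (x∉ ∘ there)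

∈-remove⁻ : ∀ w l {v} → v ∈ remove w l → v ∈ l × v ≢ w
∈-remove⁻ w l v∈ with ∈-filter⁻ (T? ∘ λ y → not (y ≡ᵇ w)) v∈
... | v∈l , kept = v∈l , λ { refl → subst (T ∘ not) (≡ᵇ-refl w) kept }

∈-remove⁺ : ∀ w {l v} → v ∈ l → v ≢ w → v ∈ remove w l
∈-remove⁺ w v∈l v≢w =
  ∈-filter⁺ (T? ∘ λ y → not (y ≡ᵇ w)) v∈l (subst (T ∘ not) (sym (≢⇒≡ᵇ-false v≢w)) _)

∈⇒≤max : ∀ {x} l → x ∈ l → x ≤ foldr _⊔_ 0 l
∈⇒≤max (y ∷ l) (here refl) = m≤m⊔n y _
∈⇒≤max (y ∷ l) (there x∈) = ≤-trans (∈⇒≤max l x∈) (m≤n⊔m y _)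

∈⇒<fresh : ∀ {x} l → x ∈ l → x < fresh l
∈⇒<fresh l x∈ = s≤s (∈⇒≤max l x∈)

fresh∉ : ∀ l → fresh l ∉ l
fresh∉ l x∈ = n≮n _ (∈⇒<fresh l x∈)

freshNames : (L : List ℕ) (n : ℕ) →
             Σ (List ℕ) λ βs → length βs ≡ n × Unique βs × (∀ β → β ∈ βs → β ∉ L)
freshNames L n = applyUpTo (fresh L +_) n , length-applyUpTo _ n , unique , avoids
  where
    unique : Unique (applyUpTo (fresh L +_) n)
    unique = applyUpTo⁺₁ _ n λ i<j _ → <⇒≢ i<j ∘ +-cancelˡ-≡ (fresh L) _ _
    avoids : ∀ β → β ∈ applyUpTo (fresh L +_) n → β ∉ L
    avoids β β∈ β∈L with ∈-applyUpTo⁻ (fresh L +_) β∈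
    ... | i , _ , refl = <⇒≱ (∈⇒<fresh L β∈L) (m≤m+n (fresh L) i)

fv⊆vars : ∀ t → fv t ⊆ vars t
fv⊆vars (var x)   y∈ = y∈
fv⊆vars (lam x t) y∈ = there (fv⊆vars t (proj₁ (∈-remove⁻ x (fv t) y∈)))
fv⊆vars (app t u) y∈ with ∈-++⁻ (fv t) y∈
... | inj₁ y∈t = ∈-++⁺ˡ (fv⊆vars t y∈t)
... | inj₂ y∈u = ∈-++⁺ʳ (vars t) (fv⊆vars u y∈u)

bv⊆vars : ∀ t → bv t ⊆ vars t
bv⊆vars (lam x t) (here refl) = here refl
bv⊆vars (lam x t) (there y∈)  = there (bv⊆vars t y∈)
bv⊆vars (app t u) y∈ with ∈-++⁻ (bv t) y∈
... | inj₁ y∈t = ∈-++⁺ˡ (bv⊆vars t y∈t)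
... | inj₂ y∈u = ∈-++⁺ʳ (vars t) (bv⊆vars u y∈u)

Ren : Set
Ren = Var → Var

_[_↦ᵛ_] : Ren → Var → Var → Ren
(ρ [ x ↦ᵛ k ]) y = if y ≡ᵇ x then k else ρ y

↦ᵛ-same : ∀ ρ x k → (ρ [ x ↦ᵛ k ]) x ≡ k
↦ᵛ-same ρ x k rewrite ≡ᵇ-refl x = refl

↦ᵛ-other : ∀ ρ {x} k {y} → y ≢ x → (ρ [ x ↦ᵛ k ]) y ≡ ρ y
↦ᵛ-other ρ k y≢x rewrite ≢⇒≡ᵇ-false y≢x = refl

↦ᵛ-fixed : ∀ ρ {k} → ρ k ≡ k → ∀ y → (ρ [ k ↦ᵛ k ]) y ≡ ρ y
↦ᵛ-fixed ρ {k} ρk≡k y with y ≟ k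
... | yes refl = trans (↦ᵛ-same ρ y y) (sym ρk≡k)
... | no y≢k   = ↦ᵛ-other ρ k y≢k

rename : Ren → Term → Term
rename ρ (var x)   = var (ρ x)
rename ρ (lam w s) = lam w (rename (ρ [ w ↦ᵛ w ]) s)
rename ρ (app t u) = app (rename ρ t) (rename ρ u)

#binders : Term → ℕ
#binders (var x)   = 0
#binders (lam x t) = suc (#binders t)
#binders (app t u) = #binders t + #binders u

relabel : Ren → ℕ → Term → Term
relabel ρ k (var x)   = var (ρ x)
relabel ρ k (lam x t) = lam k (relabel (ρ [ x ↦ᵛ k ]) (suc k) t)
relabel ρ k (app t u) = app (relabel ρ k t) (relabel ρ (k + #binders t) u)

AgreeOn : Term → Ren → Ren → Set
AgreeOn t ρ ρ′ = ∀ y → y ∈ fv t → ρ y ≡ ρ′ y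

↦ᵛ-cong : ∀ {ρ ρ′} w s k → AgreeOn (lam w s) ρ ρ′ → AgreeOn s (ρ [ w ↦ᵛ k ]) (ρ′ [ w ↦ᵛ k ])
↦ᵛ-cong {ρ} {ρ′} w s k agree y y∈ with y ≟ w
... | yes refl = trans (↦ᵛ-same ρ y k) (sym (↦ᵛ-same ρ′ y k))
... | no y≢w   = begin
  (ρ [ w ↦ᵛ k ]) y   ≡⟨ ↦ᵛ-other ρ k y≢w ⟩
  ρ y                ≡⟨ agree y (∈-remove⁺ w y∈ y≢w) ⟩
  ρ′ y               ≡⟨ ↦ᵛ-other ρ′ k y≢w ⟨
  (ρ′ [ w ↦ᵛ k ]) y  ∎
  where open ≡-Reasoning

AgreeOn-appˡ : ∀ {ρ ρ′} t u → AgreeOn (app t u) ρ ρ′ → AgreeOn t ρ ρ′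
AgreeOn-appˡ t u agree y = agree y ∘ ∈-++⁺ˡ

AgreeOn-appʳ : ∀ {ρ ρ′} t u → AgreeOn (app t u) ρ ρ′ → AgreeOn u ρ ρ′
AgreeOn-appʳ t u agree y = agree y ∘ ∈-++⁺ʳ (fv t)

rename-cong : ∀ t {ρ ρ′} → AgreeOn t ρ ρ′ → rename ρ t ≡ rename ρ′ t
rename-cong (var x)   agree = cong var (agree x (here refl))
rename-cong (lam w s) agree = cong (lam w) (rename-cong s (↦ᵛ-cong w s w agree))
rename-cong (app t u) agree =
  cong₂ app (rename-cong t (AgreeOn-appˡ t u agree)) (rename-cong u (AgreeOn-appʳ t u agree))

relabel-cong : ∀ t {ρ ρ′ k} → AgreeOn t ρ ρ′ → relabel ρ k t ≡ relabel ρ′ k t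
relabel-cong (var x)   agree = cong var (agree x (here refl))
relabel-cong (lam w s) {k = k} agree = cong (lam k) (relabel-cong s (↦ᵛ-cong w s k agree))
relabel-cong (app t u) agree =
  cong₂ app (relabel-cong t (AgreeOn-appˡ t u agree)) (relabel-cong u (AgreeOn-appʳ t u agree))

rename-id : ∀ t {ρ} → AgreeOn t ρ id → rename ρ t ≡ t
rename-id (var x)   agree = cong var (agree x (here refl))
rename-id (lam w s) agree =
  cong (lam w) (trans (rename-cong s (↦ᵛ-cong w s w agree)) (rename-id s fixes))
  where
    fixes : AgreeOn s (id [ w ↦ᵛ w ]) id
    fixes y _ = ↦ᵛ-fixed id refl y
rename-id (app t u) agree =
  cong₂ app (rename-id t (AgreeOn-appˡ t u agree)) (rename-id u (AgreeOn-appʳ t u agree))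

NoCapture : Ren → Term → Set
NoCapture ρ t = ∀ y → y ∈ fv t → ρ y ≡ y ⊎ ρ y ∉ bv t

NoCapture-mono : ∀ {ρ} t t′ → fv t′ ⊆ fv t → bv t′ ⊆ bv t → NoCapture ρ t → NoCapture ρ t′
NoCapture-mono t t′ fv⊆ bv⊆ noCapture y y∈ = map₂ (_∘ bv⊆) (noCapture y (fv⊆ y∈))

NoCapture-appˡ : ∀ {ρ} t u → NoCapture ρ (app t u) → NoCapture ρ t
NoCapture-appˡ t u = NoCapture-mono (app t u) t ∈-++⁺ˡ ∈-++⁺ˡ

NoCapture-appʳ : ∀ {ρ} t u → NoCapture ρ (app t u) → NoCapture ρ u
NoCapture-appʳ t u = NoCapture-mono (app t u) u (∈-++⁺ʳ (fv t)) (∈-++⁺ʳ (bv t))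

NoCapture-lam : ∀ {ρ} w s → NoCapture ρ (lam w s) → NoCapture (ρ [ w ↦ᵛ w ]) s
NoCapture-lam {ρ} w s noCapture y y∈ with y ≟ w
... | yes refl = inj₁ (↦ᵛ-same ρ y y)
... | no y≢w rewrite ↦ᵛ-other ρ w y≢w = map₂ (_∘ there) (noCapture y (∈-remove⁺ w y∈ y≢w))

NoCapture⇒≢binder : ∀ {ρ} w s {y} → NoCapture ρ (lam w s) → y ∈ fv (lam w s) → ρ y ≢ w
NoCapture⇒≢binder w s noCapture y∈ ρy≡w with noCapture _ y∈
... | inj₁ ρy≡y = proj₂ (∈-remove⁻ w (fv s) y∈) (trans (sym ρy≡y) ρy≡w)
... | inj₂ ρy∉  = ρy∉ (here ρy≡w)

ssub-lam-keep : ∀ σ w s → w ∉ concatMap (fv ∘ σ) (fv (lam w s)) →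
                ssub σ (lam w s) ≡ lam w (ssub (σ [ w ↦ var w ]) s)
ssub-lam-keep σ w s w∉ rewrite memᵇ-false _ w∉ = refl

ssub≡rename : ∀ t {σ ρ} → (∀ y → σ y ≡ var (ρ y)) → NoCapture ρ t → ssub σ t ≡ rename ρ t
ssub≡rename (var x)   σ≗ _ = σ≗ x
ssub≡rename (app t u) σ≗ noCapture =
  cong₂ app (ssub≡rename t σ≗ (NoCapture-appˡ t u noCapture))
            (ssub≡rename u σ≗ (NoCapture-appʳ t u noCapture))
ssub≡rename (lam w s) {σ} {ρ} σ≗ noCapture =
  trans (ssub-lam-keep σ w s w∉) (cong (lam w) (ssub≡rename s σ≗′ (NoCapture-lam w s noCapture)))
  where
    w∉ : w ∉ concatMap (fv ∘ σ) (fv (lam w s))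
    w∉ w∈ with find (∈-concatMap⁻ (fv ∘ σ) w∈)
    ... | y , y∈ , w∈σy rewrite σ≗ y with w∈σy
    ... | here w≡ρy = NoCapture⇒≢binder w s noCapture y∈ (sym w≡ρy)
    σ≗′ : ∀ y → (σ [ w ↦ var w ]) y ≡ var ((ρ [ w ↦ᵛ w ]) y)
    σ≗′ y with y ≟ w
    ... | yes refl rewrite ≡ᵇ-refl y = refl
    ... | no y≢w rewrite ≢⇒≡ᵇ-false y≢w = σ≗ y

subst-var≡rename : ∀ t a {z} → z ∉ bv t → t ⟦ a ≔ var z ⟧ ≡ rename (id [ a ↦ᵛ z ]) t
subst-var≡rename t a {z} z∉ = ssub≡rename t pointwise noCapture
  where
    pointwise : ∀ y → (var [ a ↦ var z ]) y ≡ var ((id [ a ↦ᵛ z ]) y)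
    pointwise y with y ≡ᵇ a
    ... | true  = refl
    ... | false = refl
    noCapture : NoCapture (id [ a ↦ᵛ z ]) t
    noCapture y _ with y ≟ a
    ... | yes refl rewrite ↦ᵛ-same id y z = inj₂ z∉
    ... | no y≢a = inj₁ (↦ᵛ-other id z y≢a)

rename-relabel : ∀ t {ρ ρ′ k} → (∀ v → k ≤ v → ρ′ v ≡ v) →
                 rename ρ′ (relabel ρ k t) ≡ relabel (ρ′ ∘ ρ) k t
rename-relabel (var x) _ = refl
rename-relabel (app t u) {k = k} fixes =
  cong₂ app (rename-relabel t fixes)
            (rename-relabel u λ v k+n≤v → fixes v (≤-trans (m≤m+n k (#binders t)) k+n≤v))
rename-relabel (lam x t) {ρ} {ρ′} {k} fixes = cong (lam k) (begin
  rename (ρ′ [ k ↦ᵛ k ]) (relabel (ρ [ x ↦ᵛ k ]) (suc k) t)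
    ≡⟨ rename-cong (relabel (ρ [ x ↦ᵛ k ]) (suc k) t) (λ y _ → ↦ᵛ-fixed ρ′ (fixes k ≤-refl) y) ⟩
  rename ρ′ (relabel (ρ [ x ↦ᵛ k ]) (suc k) t)
    ≡⟨ rename-relabel t (λ v k<v → fixes v (≤-trans (n≤1+n k) k<v)) ⟩
  relabel (ρ′ ∘ (ρ [ x ↦ᵛ k ])) (suc k) t
    ≡⟨ relabel-cong t pointwise ⟩
  relabel ((ρ′ ∘ ρ) [ x ↦ᵛ k ]) (suc k) t ∎)
  where
    open ≡-Reasoning
    pointwise : AgreeOn t (ρ′ ∘ (ρ [ x ↦ᵛ k ])) ((ρ′ ∘ ρ) [ x ↦ᵛ k ])
    pointwise y _ with y ≟ x
    ... | yes refl = trans (cong ρ′ (↦ᵛ-same ρ y k))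
                           (trans (fixes k ≤-refl) (sym (↦ᵛ-same (ρ′ ∘ ρ) y k)))
    ... | no y≢x   = trans (cong ρ′ (↦ᵛ-other ρ k y≢x)) (sym (↦ᵛ-other (ρ′ ∘ ρ) k y≢x))

rename-∘ : ∀ t {ρ ρ′} → NoCapture ρ t → rename ρ′ (rename ρ t) ≡ rename (ρ′ ∘ ρ) t
rename-∘ (var x)   _ = refl
rename-∘ (app t u) noCapture =
  cong₂ app (rename-∘ t (NoCapture-appˡ t u noCapture)) (rename-∘ u (NoCapture-appʳ t u noCapture))
rename-∘ (lam w s) {ρ} {ρ′} noCapture =
  cong (lam w) (trans (rename-∘ s (NoCapture-lam w s noCapture)) (rename-cong s pointwise))
  where
    open ≡-Reasoning
    pointwise : AgreeOn s ((ρ′ [ w ↦ᵛ w ]) ∘ (ρ [ w ↦ᵛ w ])) ((ρ′ ∘ ρ) [ w ↦ᵛ w ])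
    pointwise y y∈ with y ≟ w
    ... | yes refl = trans (cong (ρ′ [ y ↦ᵛ y ]) (↦ᵛ-same ρ y y))
                           (trans (↦ᵛ-same ρ′ y y) (sym (↦ᵛ-same (ρ′ ∘ ρ) y y)))
    ... | no y≢w = begin
      (ρ′ [ w ↦ᵛ w ]) ((ρ [ w ↦ᵛ w ]) y) ≡⟨ cong (ρ′ [ w ↦ᵛ w ]) (↦ᵛ-other ρ w y≢w) ⟩
      (ρ′ [ w ↦ᵛ w ]) (ρ y)              ≡⟨ ↦ᵛ-other ρ′ w ρy≢w ⟩
      ρ′ (ρ y)                           ≡⟨ ↦ᵛ-other (ρ′ ∘ ρ) w y≢w ⟨
      ((ρ′ ∘ ρ) [ w ↦ᵛ w ]) y            ∎
      where ρy≢w = NoCapture⇒≢binder w s noCapture (∈-remove⁺ w y∈ y≢w)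

FreeOffRange : Ren → ℕ → Term → Set
FreeOffRange ρ k t = ∀ y → y ∈ fv t → ρ y < k ⊎ k + #binders t ≤ ρ y

FreeOffRange-lam : ∀ x t {ρ k z} → FreeOffRange ρ k (lam x t) → k + #binders t < z →
                   FreeOffRange (ρ [ x ↦ᵛ z ]) (suc k) t
FreeOffRange-lam x t {ρ} {k} {z} off beyond y y∈ with y ≟ x
... | yes refl rewrite ↦ᵛ-same ρ y z = inj₂ beyond
... | no y≢x rewrite ↦ᵛ-other ρ z y≢x =
  Sum.map m<n⇒m<1+n (subst (_≤ ρ y) (+-suc k (#binders t))) (off y (∈-remove⁺ x y∈ y≢x))

NoCapture-lam-fresh : ∀ x t {ρ z} → NoCapture ρ (lam x t) → z ∉ bv t → NoCapture (ρ [ x ↦ᵛ z ]) t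
NoCapture-lam-fresh x t {ρ} {z} noCapture z∉ y y∈ with y ≟ x
... | yes refl rewrite ↦ᵛ-same ρ y z = inj₂ z∉
... | no y≢x rewrite ↦ᵛ-other ρ z y≢x = map₂ (_∘ there) (noCapture y (∈-remove⁺ x y∈ y≢x))

relabel-instantiate : ∀ x t {ρ k z} → FreeOffRange ρ k (lam x t) →
                      z ∉ bv (relabel (ρ [ x ↦ᵛ k ]) (suc k) t) →
                      relabel (ρ [ x ↦ᵛ k ]) (suc k) t ⟦ k ≔ var z ⟧
                        ≡ relabel (ρ [ x ↦ᵛ z ]) (suc k) t
relabel-instantiate x t {ρ} {k} {z} off z∉ = begin
  relabel (ρ [ x ↦ᵛ k ]) (suc k) t ⟦ k ≔ var z ⟧
    ≡⟨ subst-var≡rename (relabel (ρ [ x ↦ᵛ k ]) (suc k) t) k z∉ ⟩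
  rename (id [ k ↦ᵛ z ]) (relabel (ρ [ x ↦ᵛ k ]) (suc k) t)
    ≡⟨ rename-relabel t (λ v k<v → ↦ᵛ-other id z (>⇒≢ k<v)) ⟩
  relabel ((id [ k ↦ᵛ z ]) ∘ (ρ [ x ↦ᵛ k ])) (suc k) t
    ≡⟨ relabel-cong t agree ⟩
  relabel (ρ [ x ↦ᵛ z ]) (suc k) t ∎
  where
    open ≡-Reasoning
    ρy≢k : ∀ {y} → y ∈ fv t → y ≢ x → ρ y ≢ k
    ρy≢k y∈ y≢x ρy≡k with off _ (∈-remove⁺ x y∈ y≢x)
    ... | inj₁ ρy<k   = <⇒≢ ρy<k ρy≡k
    ... | inj₂ k+n≤ρy = m+1+n≰m k (subst (k + suc (#binders t) ≤_) ρy≡k k+n≤ρy)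
    agree : AgreeOn t ((id [ k ↦ᵛ z ]) ∘ (ρ [ x ↦ᵛ k ])) (ρ [ x ↦ᵛ z ])
    agree y y∈ with y ≟ x
    ... | yes refl = trans (cong (id [ k ↦ᵛ z ]) (↦ᵛ-same ρ y k))
                           (trans (↦ᵛ-same id k z) (sym (↦ᵛ-same ρ y z)))
    ... | no y≢x   = trans (cong (id [ k ↦ᵛ z ]) (↦ᵛ-other ρ k y≢x))
                           (trans (↦ᵛ-other id z (ρy≢k y∈ y≢x)) (sym (↦ᵛ-other ρ z y≢x)))

rename-instantiate : ∀ x t {ρ z} → NoCapture ρ (lam x t) → z ∉ bv (rename (ρ [ x ↦ᵛ x ]) t) →
                     rename (ρ [ x ↦ᵛ x ]) t ⟦ x ≔ var z ⟧ ≡ rename (ρ [ x ↦ᵛ z ]) t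
rename-instantiate x t {ρ} {z} noCapture z∉ = begin
  rename (ρ [ x ↦ᵛ x ]) t ⟦ x ≔ var z ⟧
    ≡⟨ subst-var≡rename (rename (ρ [ x ↦ᵛ x ]) t) x z∉ ⟩
  rename (id [ x ↦ᵛ z ]) (rename (ρ [ x ↦ᵛ x ]) t)
    ≡⟨ rename-∘ t (NoCapture-lam x t noCapture) ⟩
  rename ((id [ x ↦ᵛ z ]) ∘ (ρ [ x ↦ᵛ x ])) t
    ≡⟨ rename-cong t agree ⟩
  rename (ρ [ x ↦ᵛ z ]) t ∎
  where
    open ≡-Reasoning
    agree : AgreeOn t ((id [ x ↦ᵛ z ]) ∘ (ρ [ x ↦ᵛ x ])) (ρ [ x ↦ᵛ z ])
    agree y y∈ with y ≟ x
    ... | yes refl = trans (cong (id [ y ↦ᵛ z ]) (↦ᵛ-same ρ y y))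
                           (trans (↦ᵛ-same id y z) (sym (↦ᵛ-same ρ y z)))
    ... | no y≢x   = trans (cong (id [ x ↦ᵛ z ]) (↦ᵛ-other ρ x y≢x))
                           (trans (↦ᵛ-other id z ρy≢x) (sym (↦ᵛ-other ρ z y≢x)))
      where ρy≢x = NoCapture⇒≢binder x t noCapture (∈-remove⁺ x y∈ y≢x)

-- Instantiating both binders with a fresh z turns both bodies into renamings of t, which
-- leaves the same statement for ρ [ x ↦ᵛ z ].
relabel≈rename : ∀ t {ρ k} → FreeOffRange ρ k t → NoCapture ρ t → relabel ρ k t =α rename ρ t
relabel≈rename (var x) _ _ = var _
relabel≈rename (app t u) {ρ} {k} off noCapture =
  app (relabel≈rename t offˡ (NoCapture-appˡ t u noCapture))
      (relabel≈rename u offʳ (NoCapture-appʳ t u noCapture))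
  where
    offˡ : FreeOffRange ρ k t
    offˡ y y∈ = map₂ (≤-trans (+-monoʳ-≤ k (m≤m+n (#binders t) (#binders u)))) (off y (∈-++⁺ˡ y∈))
    offʳ : FreeOffRange ρ (k + #binders t) u
    offʳ y y∈ = Sum.map (λ ρy<k → <-≤-trans ρy<k (m≤m+n k (#binders t)))
                        (subst (_≤ ρ y) (sym (+-assoc k (#binders t) (#binders u))))
                        (off y (∈-++⁺ʳ (fv t) y∈))
relabel≈rename (lam x t) {ρ} {k} off noCapture =
  lam z (z∉ ∘ there ∘ ∈-++⁺ˡ) (z∉ ∘ there ∘ ∈-++⁺ʳ (vars (lam k left)) ∘ ∈-++⁺ˡ)
      (subst₂ _=α_ (sym left≡) (sym right≡) (relabel≈rename t off′ noCapture′))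
  where
    left right : Term
    left  = relabel (ρ [ x ↦ᵛ k ]) (suc k) t
    right = rename (ρ [ x ↦ᵛ x ]) t
    L : List Var
    L = k + #binders t ∷ vars (lam k left) ++ vars (lam x right) ++ bv t
    z : Var
    z = fresh L
    z∉ : z ∉ L
    z∉ = fresh∉ L
    left≡ : left ⟦ k ≔ var z ⟧ ≡ relabel (ρ [ x ↦ᵛ z ]) (suc k) t
    left≡ = relabel-instantiate x t off (z∉ ∘ there ∘ ∈-++⁺ˡ ∘ there ∘ bv⊆vars left)
    right≡ : right ⟦ x ≔ var z ⟧ ≡ rename (ρ [ x ↦ᵛ z ]) t
    right≡ = rename-instantiate x t noCapture
               (z∉ ∘ there ∘ ∈-++⁺ʳ (vars (lam k left)) ∘ ∈-++⁺ˡ ∘ there ∘ bv⊆vars right)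
    off′ : FreeOffRange (ρ [ x ↦ᵛ z ]) (suc k) t
    off′ = FreeOffRange-lam x t off (∈⇒<fresh L (here refl))
    noCapture′ : NoCapture (ρ [ x ↦ᵛ z ]) t
    noCapture′ = NoCapture-lam-fresh x t noCapture
                   (z∉ ∘ there ∘ ∈-++⁺ʳ (vars (lam k left)) ∘ ∈-++⁺ʳ (vars (lam x right)))

bv-relabel-range : ∀ t {ρ k v} → v ∈ bv (relabel ρ k t) → k ≤ v × v < k + #binders t
bv-relabel-range (lam x t) {k = k} (here refl) = ≤-refl , m<m+n k (s≤s z≤n)
bv-relabel-range (lam x t) {k = k} {v} (there v∈) with bv-relabel-range t v∈
... | k<v , v<end = ≤-trans (n≤1+n k) k<v , subst (v <_) (sym (+-suc k (#binders t))) v<end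
bv-relabel-range (app t u) {ρ} {k} {v} v∈ with ∈-++⁻ (bv (relabel ρ k t)) v∈
... | inj₁ v∈t = Product.map₂ (λ v<end → <-≤-trans v<end (+-monoʳ-≤ k (m≤m+n _ (#binders u))))
                              (bv-relabel-range t v∈t)
... | inj₂ v∈u = Product.map (≤-trans (m≤m+n k (#binders t)))
                             (subst (v <_) (+-assoc k (#binders t) (#binders u)))
                             (bv-relabel-range u v∈u)

relabel-wellNamed : ∀ t {ρ k} → WellNamed (relabel ρ k t)
relabel-wellNamed (var x) = []
relabel-wellNamed (lam x t) =
  All.tabulate (λ v∈ k≡v → <⇒≢ (proj₁ (bv-relabel-range t v∈)) k≡v) ∷ relabel-wellNamed t
relabel-wellNamed (app t u) {ρ} {k} = ++⁺ (relabel-wellNamed t) (relabel-wellNamed u) disjoint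
  where
    disjoint : ∀ {v} → ¬ (v ∈ bv (relabel ρ k t) × v ∈ bv (relabel ρ (k + #binders t) u))
    disjoint (v∈t , v∈u) = <⇒≱ (proj₂ (bv-relabel-range t v∈t)) (proj₁ (bv-relabel-range u v∈u))

wellNamedRenaming : (L : List Var) (u : Term) →
  Σ Term λ t′ → (t′ =α u) × WellNamed t′ × (∀ y → y ∈ bv t′ → y ∉ L)
wellNamedRenaming L u =
  relabel id N u ,
  subst (relabel id N u =α_) (rename-id u λ _ _ → refl) (relabel≈rename u off (λ _ _ → inj₁ refl)) ,
  relabel-wellNamed u ,
  λ y y∈ y∈L → <⇒≱ (∈⇒<fresh (L ++ vars u) (∈-++⁺ˡ y∈L)) (proj₁ (bv-relabel-range u y∈))
  where
    N : ℕ
    N = fresh (L ++ vars u)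
    off : FreeOffRange id N u
    off y y∈ = inj₁ (∈⇒<fresh (L ++ vars u) (∈-++⁺ʳ L (fv⊆vars u y∈)))

holes-replace : ∀ B α C {β} → β ∈ holes (replace B α C) → (β ∈ holes B × β ≢ α) ⊎ β ∈ holes C
holes-replace (hole γ) α C β∈ with γ ≟ α
... | yes refl rewrite ≡ᵇ-refl γ = inj₂ β∈
... | no γ≢α rewrite ≢⇒≡ᵇ-false γ≢α with β∈
...   | here refl = inj₁ (here refl , γ≢α)
holes-replace (clam x B) α C β∈ = holes-replace B α C β∈
holes-replace (capp B D) α C β∈ with ∈-++⁻ (holes (replace B α C)) β∈
... | inj₁ β∈B = Sum.map₁ (Product.map₁ ∈-++⁺ˡ) (holes-replace B α C β∈B)
... | inj₂ β∈D = Sum.map₁ (Product.map₁ (∈-++⁺ʳ (holes B))) (holes-replace D α C β∈D)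

holes-foldl-capp : ∀ βs C {β} → β ∈ holes (foldl (λ C β → capp C (hole β)) C βs) →
                   β ∈ holes C ⊎ β ∈ βs
holes-foldl-capp []       C β∈ = inj₁ β∈
holes-foldl-capp (γ ∷ βs) C β∈ with holes-foldl-capp βs (capp C (hole γ)) β∈
... | inj₂ β∈βs = inj₂ (there β∈βs)
... | inj₁ β∈Cγ with ∈-++⁻ (holes C) β∈Cγ
...   | inj₁ β∈C = inj₁ β∈C
...   | inj₂ (here refl) = inj₂ (here refl)

mutual
  IsB-replace : ∀ {B C} α → IsB B → IsB C → IsB (replace B α C)
  IsB-replace α (bhole β) isC with β ≟ α
  ... | yes refl rewrite ≡ᵇ-refl β = isC
  ... | no β≢α rewrite ≢⇒≡ᵇ-false β≢α = bhole β
  IsB-replace α (brig r) isC = brig (IsR-replace α r isC)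
  IsB-replace α (blam b) isC = blam (IsB-replace α b isC)

  IsR-replace : ∀ {B C} α → IsR B → IsB C → IsR (replace B α C)
  IsR-replace α (rvar x)   isC = rvar x
  IsR-replace α (rapp r b) isC = rapp (IsR-replace α r isC) (IsB-replace α b isC)

IsR-foldl-capp : ∀ βs {C} → IsR C → IsR (foldl (λ C β → capp C (hole β)) C βs)
IsR-foldl-capp []       r = r
IsR-foldl-capp (β ∷ βs) r = IsR-foldl-capp βs (rapp r (bhole β))

-- A rigid context is never an abstraction, so applying it creates no redex.
app-normal : ∀ {C f g} → IsR C → C ≡ toCtx f → BetaNormal f → BetaNormal g → BetaNormal (app f g)
app-normal () refl _ _ here
app-normal _ _ f-normal _ (appl r) = f-normal r
app-normal _ _ _ g-normal (appr r) = g-normal r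

mutual
  IsB⇒normal : ∀ {B} → IsB B → (∀ α → α ∉ holes B) → Σ Term λ f → BetaNormal f × B ≡ toCtx f
  IsB⇒normal (bhole α) noHoles = ⊥-elim (noHoles α (here refl))
  IsB⇒normal (brig r) noHoles = IsR⇒normal r noHoles
  IsB⇒normal (blam {x} b) noHoles with IsB⇒normal b noHoles
  ... | f , f-normal , refl = lam x f , (λ { (under r) → f-normal r }) , refl

  IsR⇒normal : ∀ {B} → IsR B → (∀ α → α ∉ holes B) → Σ Term λ f → BetaNormal f × B ≡ toCtx f
  IsR⇒normal (rvar x) _ = var x , (λ ()) , refl
  IsR⇒normal (rapp {C} r b) noHoles
    with IsR⇒normal r (λ α → noHoles α ∘ ∈-++⁺ˡ) | IsB⇒normal b (λ α → noHoles α ∘ ∈-++⁺ʳ (holes C))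
  ... | f , f-normal , refl | g , g-normal , refl =
    app f g , app-normal r refl f-normal g-normal , refl

lookupEnv-nothing⇒∉dom : ∀ E {x} → lookupEnv E x ≡ nothing → x ∉ dom E
lookupEnv-nothing⇒∉dom ((y , t) ∷ E) {x} notFound x∈ with x ≟ y
... | yes refl rewrite ≡ᵇ-refl x with () ← notFound
... | no x≢y rewrite ≢⇒≡ᵇ-false x≢y with x∈
...   | here x≡y  = x≢y x≡y
...   | there x∈E = lookupEnv-nothing⇒∉dom E notFound x∈E

names-zipWith-job : ∀ ts βs → length βs ≡ length ts →
                    map nm (zipWith (λ t β → job t [] β) ts βs) ≡ βs
names-zipWith-job []       []       _ = refl
names-zipWith-job (t ∷ ts) (β ∷ βs) length≡ =
  cong (β ∷_) (names-zipWith-job ts βs (suc-injective length≡))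

∉-all⇒≡[] : ∀ {A : Set} {l : List A} → (∀ x → x ∉ l) → l ≡ []
∉-all⇒≡[] {l = []}    _     = refl
∉-all⇒≡[] {l = x ∷ l} empty = ⊥-elim (empty x (here refl))

module FinalStates (T : PoolTemplate) where
  open PoolTemplate T
  open Exam T

  sel-name : ∀ {P j P′} → sel P j P′ → nm j ∈ names P
  sel-name {P} sl = from (names-supp P _) (_ , sel-mem sl , refl)

  sel-∉names : ∀ {P j P′} → sel P j P′ → nm j ∉ names P′
  sel-∉names {P} {j} {P′} sl j∈ with to (names-supp P′ (nm j)) j∈
  ... | j′ , j′∈ , same with to (sel-supp sl j′) j′∈
  ...   | j′∈P , j′≢j = j′≢j (supp-inj P j′ j j′∈P (sel-mem sl) same)

  sel-names⁻ : ∀ {P j P′} → sel P j P′ → names P′ ⊆ names P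
  sel-names⁻ {P} {P′ = P′} sl β∈ with to (names-supp P′ _) β∈
  ... | j′ , j′∈ , refl = from (names-supp P _) (j′ , proj₁ (to (sel-supp sl j′) j′∈) , refl)

  sel-names⁺ : ∀ {P j P′ β} → sel P j P′ → β ∈ names P → β ≢ nm j → β ∈ names P′
  sel-names⁺ {P} {P′ = P′} sl β∈ β≢ with to (names-supp P _) β∈
  ... | j′ , j′∈ , refl =
    from (names-supp P′ _) (j′ , from (sel-supp sl j′) (j′∈ , λ { refl → β≢ refl }) , refl)

  Extends : Pool → Pool → Job → Set
  Extends Q P j = ∀ j′ → (j′ ∈ supp Q) ⇔ (j′ ∈ supp P ⊎ j′ ≡ j)

  names-extends⁺ : ∀ {Q P j β} → Extends Q P j → β ∈ names P ⊎ β ≡ nm j → β ∈ names Q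
  names-extends⁺ {Q} {P} extends (inj₁ β∈) with to (names-supp P _) β∈
  ... | j′ , j′∈ , refl = from (names-supp Q _) (j′ , from (extends j′) (inj₁ j′∈) , refl)
  names-extends⁺ {Q} extends (inj₂ refl) =
    from (names-supp Q _) (_ , from (extends _) (inj₂ refl) , refl)

  names-extends⁻ : ∀ {Q P j β} → Extends Q P j → β ∈ names Q → β ∈ names P ⊎ β ≡ nm j
  names-extends⁻ {Q} {P} extends β∈ with to (names-supp Q _) β∈
  ... | j′ , j′∈ , refl with to (extends j′) j′∈
  ...   | inj₁ j′∈P = inj₁ (from (names-supp P _) (j′ , j′∈P , refl))
  ...   | inj₂ refl = inj₂ refl

  sel-drop-names : ∀ {P j P′ j′} → sel P j P′ → nm j′ ≡ nm j → names P ⊆ names (drop j′ P′)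
  sel-drop-names {j = j} {P′} {j′} sl same {β} β∈ =
    names-extends⁺ (drop-supp j′ P′ (subst (_∉ names P′) (sym same) (sel-∉names sl))) kept
    where
      kept : β ∈ names P′ ⊎ β ≡ nm j′
      kept with β ≟ nm j
      ... | yes refl = inj₂ (sym same)
      ... | no β≢    = inj₁ (sel-names⁺ sl β∈ β≢)

  addList-names⁺ : ∀ js {Q β} → Unique (map nm js) → (∀ j → j ∈ js → nm j ∉ names Q) →
                   β ∈ names Q ⊎ β ∈ map nm js → β ∈ names (addList js Q)
  addList-names⁺ []       _ _ (inj₁ β∈) = β∈
  addList-names⁺ (j ∷ js) {Q} (j∉js ∷ unique) fresh β∈ =
    addList-names⁺ js unique fresh′ (located β∈)
    where
      extends : Extends (add j Q) Q j
      extends = add-supp j Q (fresh j (here refl))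
      fresh′ : ∀ j′ → j′ ∈ js → nm j′ ∉ names (add j Q)
      fresh′ j′ j′∈ n∈ with names-extends⁻ extends n∈
      ... | inj₁ n∈Q = fresh j′ (there j′∈) n∈Q
      ... | inj₂ same = All.lookup j∉js (∈-map⁺ nm j′∈) (sym same)
      located : ∀ {β} → β ∈ names Q ⊎ β ∈ nm j ∷ map nm js → β ∈ names (add j Q) ⊎ β ∈ map nm js
      located (inj₁ β∈Q)          = inj₁ (names-extends⁺ extends (inj₁ β∈Q))
      located (inj₂ (here refl))  = inj₁ (names-extends⁺ extends (inj₂ refl))
      located (inj₂ (there β∈js)) = inj₂ β∈js

  Invariant : State → Set
  Invariant (B , P , E) = IsB B × holes B ⊆ names P

  step-invariant : ∀ {s s′} → Invariant s → Step s s′ → Invariant s′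
  step-invariant (isB , named) (sea-app sl)   = isB , sel-drop-names sl refl ∘ named
  step-invariant (isB , named) (beta sl)      = isB , sel-drop-names sl refl ∘ named
  step-invariant (isB , named) (sub sl _ _)   = isB , sel-drop-names sl refl ∘ named
  step-invariant {B , _} (isB , named) (sea-lam {P' = P′} {x = x} {t = t} {α = α} sl) =
    IsB-replace α isB (blam (bhole α)) , named′
    where
      named′ : holes (replace B α (clam x (hole α))) ⊆ names (drop (job t [] α) P′)
      named′ β∈ with holes-replace B α _ β∈
      ... | inj₁ (β∈B , _)   = sel-drop-names sl refl (named β∈B)
      ... | inj₂ (here refl) = sel-drop-names sl refl (sel-name sl)
  step-invariant {B , _} (isB , named)
                 (sea-var {P' = P′} {x = x} {ts = ts} {α = α} sl _ βs length≡ unique fresh) =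
    IsB-replace α isB (brig (IsR-foldl-capp βs (rvar x))) , named′
    where
      js : List Job
      js = zipWith (λ t β → job t [] β) ts βs
      names-js : map nm js ≡ βs
      names-js = names-zipWith-job ts βs length≡
      js-fresh : ∀ j → j ∈ js → nm j ∉ names P′
      js-fresh j j∈ = proj₁ (fresh (nm j) (subst (nm j ∈_) names-js (∈-map⁺ nm j∈))) ∘ sel-names⁻ sl
      located : ∀ {β} → β ∈ holes (replace B α (headCtx x βs)) → β ∈ names P′ ⊎ β ∈ map nm js
      located β∈ with holes-replace B α _ β∈
      ... | inj₁ (β∈B , β≢α) = inj₁ (sel-names⁺ sl (named β∈B) β≢α)
      ... | inj₂ β∈head with holes-foldl-capp βs (cvar x) β∈head
      ...   | inj₂ β∈βs = inj₂ (subst (_ ∈_) (sym names-js) β∈βs)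
      named′ : holes (replace B α (headCtx x βs)) ⊆ names (addList js P′)
      named′ = addList-names⁺ js (subst Unique (sym names-js) unique) js-fresh ∘ located

  reachable-invariant : ∀ {s} → Reachable s → Invariant s
  reachable-invariant (start (init t t′ α _ _)) =
    bhole α , λ { (here refl) → from (names-supp _ α) (_ , from (new-supp _ _) refl , refl) }
  reachable-invariant (next reachable step) = step-invariant (reachable-invariant reachable) step

  step-from-sel : ∀ {B P E P′} j → sel P j P′ → Σ State (Step (B , P , E))
  step-from-sel (job (app t u) S α)       sl = _ , sea-app sl
  step-from-sel (job (lam x t) [] α)      sl = _ , sea-lam sl
  step-from-sel (job (lam x t) (u ∷ S) α) sl = _ , beta sl
  step-from-sel {B} {P} {E} (job (var x) S α) sl with lookupEnv E x in found
  ... | just u = _ , sub sl found (proj₂ (wellNamedRenaming (varsState (B , P , E)) u))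
  ... | nothing with freshNames (names P ++ holes B) (length S)
  ...   | βs , length≡ , unique , avoids =
    _ , sea-var sl (lookupEnv-nothing⇒∉dom E found) βs length≡ unique
                (λ β β∈ → avoids β β∈ ∘ ∈-++⁺ˡ , avoids β β∈ ∘ ∈-++⁺ʳ (names P))

  step-selects : ∀ {B P E s′} → Step (B , P , E) s′ → ∃ λ j → j ∈ supp P
  step-selects (sea-app sl)           = _ , sel-mem sl
  step-selects (beta sl)              = _ , sel-mem sl
  step-selects (sub sl _ _)           = _ , sel-mem sl
  step-selects (sea-lam sl)           = _ , sel-mem sl
  step-selects (sea-var sl _ _ _ _ _) = _ , sel-mem sl

  final⇒supp-empty : ∀ {B P E} → Final (B , P , E) → ∀ j → j ∉ supp P
  final⇒supp-empty final j j∈ with sel-exists _ j j∈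
  ... | j′ , P′ , sl = let s′ , step = step-from-sel j′ sl in final s′ step

  supp-empty⇒final : ∀ {B P E} → (∀ j → j ∉ supp P) → Final (B , P , E)
  supp-empty⇒final empty _ step = let j , j∈ = step-selects step in empty j j∈

  supp-empty⇒names-empty : ∀ {P} → (∀ j → j ∉ supp P) → ∀ α → α ∉ names P
  supp-empty⇒names-empty {P} empty α α∈ = let j , j∈ , _ = to (names-supp P α) α∈ in empty j j∈

  supp-empty⇒rb : ∀ {P} → (∀ j → j ∉ supp P) → ∀ B E → rb (B , P , E) ≡ B
  supp-empty⇒rb empty B E = cong (λ X → fill (map (jobDown E) X) B) (∉-all⇒≡[] empty)

  reachable-final⇒normal : ∀ {B P E} → Reachable (B , P , E) → Final (B , P , E) →
                           Σ Term λ f → BetaNormal f × B ≡ toCtx f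
  reachable-final⇒normal reachable final with isB , named ← reachable-invariant reachable =
    IsB⇒normal isB (λ α → supp-empty⇒names-empty (final⇒supp-empty final) α ∘ named)

proposition5 : (T : PoolTemplate) → let open PoolTemplate T in let open Exam T in
    (s : State) → Reachable s → Final s →
      Σ Term λ f → BetaNormal f × Σ Env λ E → Σ Pool λ P →
        (s ≡ (toCtx f , P , E)) × (∀ j → j ∉ supp P) × (rb s ≡ toCtx f) ×
        (∀ s' → s ≡s s' → Final s' × rb s' ≡ toCtx f)
proposition5 T (B , P , E) reachable final
  with f , f-normal , refl ← FinalStates.reachable-final⇒normal T reachable final =
  f , f-normal , E , P , refl , empty , supp-empty⇒rb empty (toCtx f) E , equivalent
  where
    open PoolTemplate T
    open Exam T
    open FinalStates T
    empty : ∀ j → j ∉ supp P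
    empty = final⇒supp-empty final
    equivalent : ∀ s′ → (toCtx f , P , E) ≡s s′ → Final s′ × rb s′ ≡ toCtx f
    equivalent _ (eqv {E₂ = E₂} _) = supp-empty⇒final empty , supp-empty⇒rb empty (toCtx f) E₂
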